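{- Let $C(H,u)$ be a class of the partition $\Pi(2e,K)$, where $H$ is a hyperplane of $T$ and $u\in V'$ with $ru\notin H$. Then the set of $2e$-tuples $\{\sigma(u+h):\sigma\in K^\times, h\in H\}$ contains the coset $u+T$ and can be partitioned into $q-1$ cosets of $T$ (in the additive group $K^{2e}$), with $\{z_ju : j\in\{2,\ldots,q\}\}$ a set of representatives of these cosets.
   Context: Let $e\geq 2$ and let $K$ be a finite commutative ring with identity having precisely three ideals $\{0\}$, $J=\langle r\rangle$, $K$, with $K/J\cong\mathbb{F}_q$ ($q$ a prime power). Let $\{z_1,\ldots,z_q\}$ be a set of coset representatives of $J$ in $K$ with $z_1=0$. Let $K^\times$ be the set of units, $V'$ the set of tuples in $K^{2e}$ with at least one entry in $K^\times$, for $a\in V'$ let $[a]=\{\lambda a:\lambda\in K^\times\}$, and $V=\{[a]:a\in V'\}$. Let $T=J^{2e}$, a $2e$-dimensional vector space over $K/J$ with $(z+J)\cdot x=zx$; a hyperplane is a $(2e-1)$-dimensional subspace. For $u\in K^{2e}$, $ru\in T$ is the componentwise product. For a hyperplane $H$ and $u\in V'$ with $ru\notin H$, $C(H,u)=\{[u+h]:h\in H\}$; these sets form a partition of $V$, denoted $\Pi(2e,K)$. -}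

module Defs where

open import Level using (Level; _⊔_)
open import Algebra.Bundles using (CommutativeRing)
open import Data.Nat as ℕ using (ℕ; suc)
open import Data.Nat.Primality using (Prime)
open import Data.Fin using (Fin; zero; suc)
open import Data.Product using (Σ; ∃; ∃-syntax; _×_; _,_)
open import Relation.Nullary using (¬_)
open import Relation.Binary.PropositionalEquality using (_≡_)

IsPrimePower : ℕ → Set
IsPrimePower q = ∃[ p ] ∃[ k ] (Prime p × q ≡ p ℕ.^ suc k)

module RingDefs {c ℓ : Level} (R : CommutativeRing c ℓ) where
  open CommutativeRing R hiding (zero)

  Subset : Set (Level.suc (c ⊔ ℓ))
  Subset = Carrier → Set (c ⊔ ℓ)

  IsFinite : Set (c ⊔ ℓ)
  IsFinite = ∃[ n ] Σ (Fin n → Carrier) λ f → ∀ x → ∃[ i ] (f i ≈ x)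

  record IsIdeal (I : Subset) : Set (c ⊔ ℓ) where
    field
      resp  : ∀ {x y} → x ≈ y → I x → I y
      zero∈ : I 0#
      +∈    : ∀ {x y} → I x → I y → I (x + y)
      *∈    : ∀ a {x} → I x → I (a * x)

  _≐_ : Subset → Subset → Set (c ⊔ ℓ)
  A ≐ B = ∀ x → (A x → B x) × (B x → A x)

  zeroIdeal : Subset
  zeroIdeal x = Level.Lift c (x ≈ 0#)

  wholeRing : Subset
  wholeRing x = Level.Lift (c ⊔ ℓ) Data.Unit.⊤
    where import Data.Unit

  ⟨_⟩ : Carrier → Subset
  ⟨ r ⟩ x = ∃[ a ] (x ≈ a * r)

  ExactlyThreeIdeals : Carrier → Set (Level.suc (c ⊔ ℓ))
  ExactlyThreeIdeals r =
    (¬ (⟨ r ⟩ ≐ zeroIdeal)) × (¬ (⟨ r ⟩ ≐ wholeRing)) ×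
    (∀ (I : Subset) → IsIdeal I →
       (I ≐ zeroIdeal) Data.Sum.⊎ (I ≐ ⟨ r ⟩) Data.Sum.⊎ (I ≐ wholeRing))
    where import Data.Sum

  IsCosetReps : (J : Subset) (q : ℕ) → (Fin q → Carrier) → Set (c ⊔ ℓ)
  IsCosetReps J q z =
    (∀ x → ∃[ j ] J (x - z j)) ×
    (∀ i j → J (z i - z j) → i ≡ j)

  IsUnit : Carrier → Set (c ⊔ ℓ)
  IsUnit σ = ∃[ τ ] (σ * τ ≈ 1#)

  Tup : ℕ → Set c
  Tup m = Fin m → Carrier

  _≈ᵗ_ : ∀ {m} → Tup m → Tup m → Set ℓ
  u ≈ᵗ v = ∀ k → u k ≈ v k

  _+ᵗ_ : ∀ {m} → Tup m → Tup m → Tup m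
  (u +ᵗ v) k = u k + v k

  _-ᵗ_ : ∀ {m} → Tup m → Tup m → Tup m
  (u -ᵗ v) k = u k - v k

  _·ᵗ_ : ∀ {m} → Carrier → Tup m → Tup m
  (a ·ᵗ u) k = a * u k

  0ᵗ : ∀ {m} → Tup m
  0ᵗ k = 0#

  InV' : ∀ {m} → Tup m → Set (c ⊔ ℓ)
  InV' u = ∃[ k ] IsUnit (u k)

  InT : ∀ {m} → Subset → Tup m → Set (c ⊔ ℓ)
  InT J t = ∀ k → J (t k)

  TSubset : ℕ → Set (Level.suc (c ⊔ ℓ))
  TSubset m = Tup m → Set (c ⊔ ℓ)

  Σᴷ : ∀ {n} → (Fin n → Carrier) → Carrier
  Σᴷ {ℕ.zero} f = 0#
  Σᴷ {suc n} f = f zero + Σᴷ (λ i → f (suc i))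

  lincomb : ∀ {n m} → (Fin n → Carrier) → (Fin n → Tup m) → Tup m
  lincomb cs bs k = Σᴷ (λ i → cs i * bs i k)

  -- H is a subspace of the K/J-vector space T = J^m, with scalar action
  -- (z + J)·x = z x
  record IsSubspaceOfT {m} (J : Subset) (H : TSubset m) : Set (c ⊔ ℓ) where
    field
      resp  : ∀ {x y} → x ≈ᵗ y → H x → H y
      ⊆T    : ∀ {x} → H x → InT J x
      zero∈ : H 0ᵗ
      +∈    : ∀ {x y} → H x → H y → H (x +ᵗ y)
      ·∈    : ∀ a {x} → H x → H (a ·ᵗ x)

  -- b : Fin d → Tup m is a basis of H over K/J: the b i lie in H, they are
  -- linearly independent over K/J (a combination is 0 only if all
  -- coefficients lie in J, i.e. are 0 in K/J), and they span H.
  record IsBasis {m d} (J : Subset) (H : TSubset m) (b : Fin d → Tup m) : Set (c ⊔ ℓ) where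
    field
      ∈H      : ∀ i → H (b i)
      indep   : ∀ cs → lincomb cs b ≈ᵗ 0ᵗ → ∀ i → J (cs i)
      spans   : ∀ {x} → H x → ∃[ cs ] (x ≈ᵗ lincomb cs b)

  IsHyperplane : ∀ {m} → Subset → TSubset m → Set (c ⊔ ℓ)
  IsHyperplane {m} J H =
    IsSubspaceOfT J H × ∃[ b ] IsBasis {m} {m ℕ.∸ 1} J H b

  UnitMultiples : ∀ {m} → TSubset m → Tup m → TSubset m
  UnitMultiples H u x = ∃[ σ ] ∃[ h ] (IsUnit σ × H h × x ≈ᵗ (σ ·ᵗ (u +ᵗ h)))

  InCoset : ∀ {m} → Subset → Tup m → Tup m → Set (c ⊔ ℓ)
  InCoset J a x = InT J (x -ᵗ a)

  K : Set c
  K = Carrier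

  IsZero : Carrier → Set ℓ
  IsZero x = x ≈ 0#

-- Since the only ideals of K are 0 ⊂ J ⊂ K, every element outside J = ⟨ r ⟩ is a unit,
-- and r * r = 0: otherwise r = a * r * r, and as 1 - a * r is a unit this forces r = 0.
-- So J * J = 0 and an entry a * r of a vector in T = J^m is "nonzero over K/J" exactly
-- when a is a unit; Gaussian elimination on such pivots shows that more than m vectors
-- of T are linearly dependent over K/J. Applied to t, r u and a basis of H, and using
-- r u ∉ H, this gives T = K (r u) + H, whence u + t = u + a r u + h = (1 + a r)(u + h)
-- with 1 + a r a unit. Conversely σ (u + h) ≡ z_j u mod T when σ ≡ z_j mod J, and two
-- cosets z_i u + T, z_j u + T meet only if (z_i - z_j) u_k ∈ J for a unit entry u_k,
-- i.e. i = j.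

module Submission where

open import Defs
open import Level using (_⊔_; lift; lower)
open import Algebra.Bundles using (CommutativeRing)
import Algebra.Properties.AbelianGroup as AbelianGroupProperties
import Algebra.Properties.CommutativeMonoid.Sum as CommutativeMonoidSum
import Algebra.Properties.CommutativeSemigroup as CommutativeSemigroupProperties
import Algebra.Properties.Group as GroupProperties
import Algebra.Properties.Ring as RingProperties
import Algebra.Properties.Semiring.Sum as SemiringSum
open import Data.Empty using (⊥-elim)
open import Data.Fin as Fin using (Fin; zero; suc; punchIn; punchOut)
open import Data.Fin.Properties using (any?; punchIn-punchOut)
open import Data.Nat using (ℕ; _≤_; _<_; _∸_; s≤s)
open import Data.Nat.Properties using (m≤n+m∸n)
open import Data.Product using (_×_; ∃-syntax; _,_; proj₁; proj₂)
open import Data.Sum using (_⊎_; inj₁; inj₂)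
open import Data.Unit using (tt)
open import Data.Vec.Functional using (_∷_)
open import Function using (_∘_)
open import Relation.Binary.PropositionalEquality as ≡ using (_≡_)
open import Relation.Nullary using (¬_; Dec; yes; no)
open import Relation.Nullary.Decidable using (¬?; decidable-stable)

module _ {a ℓ} (R : CommutativeRing a ℓ) where
  open CommutativeRing R hiding (zero)
  open RingDefs R
  open RingProperties ring
    using (-1*x≈-x; -‿distribˡ-*; -‿distribʳ-*; x[y-z]≈xy-xz; [y-z]x≈yx-zx)
  open GroupProperties +-group
    using (//-rightDividesˡ; //-rightDividesʳ; \\-leftDividesʳ; inverseˡ-unique)
  open AbelianGroupProperties +-abelianGroup using (⁻¹-anti-homo‿-)
  open SemiringSum semiring using (sum; *-distribʳ-sum)
  open CommutativeMonoidSum +-commutativeMonoid using (∑-distrib-+; sum-cong-≋; sum-replicate-zero)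
  module +-Comm = CommutativeSemigroupProperties +-commutativeSemigroup
  module *-Comm = CommutativeSemigroupProperties *-commutativeSemigroup
  open import Relation.Binary.Reasoning.Setoid setoid

  x≈0⇒x+y≈0⇒y≈0 : ∀ {x y} → x ≈ 0# → x + y ≈ 0# → y ≈ 0#
  x≈0⇒x+y≈0⇒y≈0 {x} {y} x≈0 x+y≈0 = begin
    y       ≈⟨ sym (+-identityˡ y) ⟩
    0# + y  ≈⟨ +-congʳ (sym x≈0) ⟩
    x + y   ≈⟨ x+y≈0 ⟩
    0#      ∎

  dx+y≈0⇒x≈-τy : ∀ {d τ x y} → d * τ ≈ 1# → d * x + y ≈ 0# → x ≈ - τ * y
  dx+y≈0⇒x≈-τy {d} {τ} {x} {y} dτ≈1 dx+y≈0 = begin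
    x              ≈⟨ sym (*-identityˡ x) ⟩
    1# * x         ≈⟨ *-congʳ (trans (sym dτ≈1) (*-comm d τ)) ⟩
    τ * d * x      ≈⟨ *-assoc τ d x ⟩
    τ * (d * x)    ≈⟨ *-congˡ (inverseˡ-unique (d * x) y dx+y≈0) ⟩
    τ * - y        ≈⟨ sym (-‿distribʳ-* τ y) ⟩
    - (τ * y)      ≈⟨ -‿distribˡ-* τ y ⟩
    - τ * y        ∎

  x*unit≈0⇒x≈0 : ∀ {x y} → IsUnit y → x * y ≈ 0# → x ≈ 0#
  x*unit≈0⇒x≈0 {x} {y} (τ , yτ≈1) xy≈0 = begin
    x              ≈⟨ sym (*-identityʳ x) ⟩
    x * 1#         ≈⟨ *-congˡ (sym yτ≈1) ⟩
    x * (y * τ)    ≈⟨ sym (*-assoc x y τ) ⟩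
    x * y * τ      ≈⟨ *-congʳ xy≈0 ⟩
    0# * τ         ≈⟨ zeroˡ τ ⟩
    0#             ∎

  unit*unit : ∀ {x y} → IsUnit x → IsUnit y → IsUnit (x * y)
  unit*unit {x} {y} (σ , xσ≈1) (τ , yτ≈1) = σ * τ , (begin
    x * y * (σ * τ)    ≈⟨ *-Comm.interchange x y σ τ ⟩
    x * σ * (y * τ)    ≈⟨ *-cong xσ≈1 yτ≈1 ⟩
    1# * 1#            ≈⟨ *-identityˡ 1# ⟩
    1#                 ∎)

  Σᴷ≡sum : ∀ {n} (f : Fin n → K) → Σᴷ f ≡ sum f
  Σᴷ≡sum {ℕ.zero} f = ≡.refl
  Σᴷ≡sum {ℕ.suc n} f = ≡.cong (f zero +_) (Σᴷ≡sum (f ∘ suc))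

  Σᴷ-zero : ∀ {n} {f : Fin n → K} → (∀ i → f i ≈ 0#) → Σᴷ f ≈ 0#
  Σᴷ-zero {n} {f} f≈0 = begin
    Σᴷ f                   ≡⟨ Σᴷ≡sum f ⟩
    sum f                  ≈⟨ sum-cong-≋ f≈0 ⟩
    sum {n} (λ _ → 0#)     ≈⟨ sum-replicate-zero n ⟩
    0#                     ∎

  Σᴷ-eliminate : ∀ {n} (cs ms us : Fin n → K) (v : K) →
    Σᴷ (λ i → - (cs i * ms i)) * v + Σᴷ (λ i → cs i * us i) ≈ Σᴷ (λ i → cs i * (us i - ms i * v))
  Σᴷ-eliminate cs ms us v = begin
    Σᴷ f * v + Σᴷ g           ≡⟨ ≡.cong₂ (λ s t → s * v + t) (Σᴷ≡sum f) (Σᴷ≡sum g) ⟩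
    sum f * v + sum g         ≈⟨ +-congʳ (*-distribʳ-sum v f) ⟩
    sum (λ i → f i * v) + sum g  ≈⟨ sym (∑-distrib-+ (λ i → f i * v) g) ⟩
    sum (λ i → f i * v + g i) ≈⟨ sum-cong-≋ (λ i → term (cs i) (ms i) (us i)) ⟩
    sum h                     ≡⟨ ≡.sym (Σᴷ≡sum h) ⟩
    Σᴷ h                      ∎
    where
    f g h : Fin _ → K
    f i = - (cs i * ms i)
    g i = cs i * us i
    h i = cs i * (us i - ms i * v)
    term : ∀ c m u → - (c * m) * v + c * u ≈ c * (u - m * v)
    term c m u = begin
      - (c * m) * v + c * u     ≈⟨ +-comm (- (c * m) * v) (c * u) ⟩
      c * u + - (c * m) * v     ≈⟨ +-congˡ (sym (-‿distribˡ-* (c * m) v)) ⟩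
      c * u - c * m * v         ≈⟨ +-congˡ (-‿cong (*-assoc c m v)) ⟩
      c * u - c * (m * v)       ≈⟨ sym (x[y-z]≈xy-xz c u (m * v)) ⟩
      c * (u - m * v)           ∎

  lincomb≈0-punchIn : ∀ {n m} {cs : Fin n → K} {ws : Fin n → Tup (ℕ.suc m)} k →
    (∀ i → ws i k ≈ 0#) → lincomb cs (λ i → ws i ∘ punchIn k) ≈ᵗ 0ᵗ → lincomb cs ws ≈ᵗ 0ᵗ
  lincomb≈0-punchIn {cs = cs} {ws} k wsk≈0 reduced≈0 l with k Fin.≟ l
  ... | yes ≡.refl = Σᴷ-zero λ i → trans (*-congˡ (wsk≈0 i)) (zeroʳ (cs i))
  ... | no k≢l =
    ≡.subst (λ l′ → lincomb cs ws l′ ≈ 0#) (punchIn-punchOut k≢l) (reduced≈0 (punchOut k≢l))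

  lincomb∈ : ∀ {m} {J : Subset} {H : TSubset m} → IsSubspaceOfT J H →
    ∀ {n} (cs : Fin n → K) {bs : Fin n → Tup m} → (∀ i → H (bs i)) → H (lincomb cs bs)
  lincomb∈ H-sub {ℕ.zero} cs bs∈H = IsSubspaceOfT.zero∈ H-sub
  lincomb∈ H-sub {ℕ.suc n} cs bs∈H = IsSubspaceOfT.+∈ H-sub
    (IsSubspaceOfT.·∈ H-sub (cs zero) (bs∈H zero)) (lincomb∈ H-sub (cs ∘ suc) (bs∈H ∘ suc))

  s∈⟨s⟩ : ∀ s → ⟨ s ⟩ s
  s∈⟨s⟩ s = 1# , sym (*-identityˡ s)

  ⟨⟩-isIdeal : ∀ s → IsIdeal ⟨ s ⟩
  ⟨⟩-isIdeal s = record
    { resp  = λ { x≈y (a , x≈as) → a , trans (sym x≈y) x≈as }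
    ; zero∈ = 0# , sym (zeroˡ s)
    ; +∈    = λ { (a , x≈as) (b , y≈bs) → a + b , trans (+-cong x≈as y≈bs) (sym (distribʳ s a b)) }
    ; *∈    = λ { a (b , x≈bs) → a * b , trans (*-congˡ x≈bs) (sym (*-assoc a b s)) }
    }

  module IdealProperties {I : Subset} (isIdeal : IsIdeal I) where
    open IsIdeal isIdeal public

    -‿∈ : ∀ {x} → I x → I (- x)
    -‿∈ {x} x∈I = resp (-1*x≈-x x) (*∈ (- 1#) x∈I)

    -∈ : ∀ {x y} → I x → I y → I (x - y)
    -∈ x∈I y∈I = +∈ x∈I (-‿∈ y∈I)

    x-y∈⇒y∈⇒x∈ : ∀ {x y} → I (x - y) → I y → I x
    x-y∈⇒y∈⇒x∈ {x} {y} x-y∈I y∈I = resp (//-rightDividesˡ y x) (+∈ x-y∈I y∈I)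

    x-y∈⇒x∈⇒y∈ : ∀ {x y} → I (x - y) → I x → I y
    x-y∈⇒x∈⇒y∈ {x} {y} x-y∈I x∈I =
      resp (trans (+-congʳ (⁻¹-anti-homo‿- x y)) (//-rightDividesˡ x y)) (+∈ (-‿∈ x-y∈I) x∈I)

    x-a∈⇒x-b∈⇒a-b∈ : ∀ {x a b} → I (x - a) → I (x - b) → I (a - b)
    x-a∈⇒x-b∈⇒a-b∈ {x} {a} {b} x-a∈I x-b∈I = resp eq (+∈ (-‿∈ x-a∈I) x-b∈I)
      where
      eq : - (x - a) + (x - b) ≈ a - b
      eq = begin
        - (x - a) + (x - b)    ≈⟨ +-congʳ (⁻¹-anti-homo‿- x a) ⟩
        a - x + (x - b)        ≈⟨ +-assoc a (- x) (x - b) ⟩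
        a + (- x + (x - b))    ≈⟨ +-congˡ (\\-leftDividesʳ x (- b)) ⟩
        a - b                  ∎

    x*unit∈⇒x∈ : ∀ {x y} → IsUnit y → I (x * y) → I x
    x*unit∈⇒x∈ {x} {y} (τ , yτ≈1) xy∈I = resp eq (*∈ τ xy∈I)
      where
      eq : τ * (x * y) ≈ x
      eq = begin
        τ * (x * y)   ≈⟨ *-Comm.x∙yz≈y∙zx τ x y ⟩
        x * (y * τ)   ≈⟨ *-congˡ yτ≈1 ⟩
        x * 1#        ≈⟨ *-identityʳ x ⟩
        x             ∎

    1∈⇒≐wholeRing : I 1# → I ≐ wholeRing
    1∈⇒≐wholeRing 1∈I x = (λ _ → lift tt) , λ _ → resp (*-identityʳ x) (*∈ x 1∈I)

    unit∉ : ¬ I 1# → ∀ {x} → IsUnit x → ¬ I x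
    unit∉ 1∉I {x} (τ , xτ≈1) x∈I = 1∉I (resp (trans (*-comm τ x) xτ≈1) (*∈ τ x∈I))

    1+∈⇒unit : ¬ I 1# → (∀ {x} → ¬ I x → IsUnit x) → ∀ {n} → I n → IsUnit (1# + n)
    1+∈⇒unit 1∉I ∉⇒unit {n} n∈I =
      ∉⇒unit λ 1+n∈I → 1∉I (resp (//-rightDividesʳ n 1#) (-∈ 1+n∈I n∈I))

    module CosetRepresentatives {q} {z : Fin q → K} (reps : IsCosetReps I q z)
                                {j₀ : Fin q} (zj₀∈I : I (z j₀)) where

      rep∈⇒≡ : ∀ {j} → I (z j) → j ≡ j₀
      rep∈⇒≡ {j} zj∈I = proj₂ reps j j₀ (-∈ zj∈I zj₀∈I)

      ∈? : ∀ x → Dec (I x)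
      ∈? x with proj₁ reps x
      ... | j , x-zj∈I with j Fin.≟ j₀
      ...   | yes ≡.refl = yes (x-y∈⇒y∈⇒x∈ x-zj∈I zj₀∈I)
      ...   | no j≢j₀ = no λ x∈I → j≢j₀ (rep∈⇒≡ (x-y∈⇒x∈⇒y∈ x-zj∈I x∈I))

      UnitMultiples⊆z·u+T : ¬ I 1# → ∀ {m} {H : TSubset m} → (∀ {h} → H h → InT I h) →
        ∀ {u} x → UnitMultiples H u x → ∃[ j ] (¬ j ≡ j₀ × InCoset I (z j ·ᵗ u) x)
      UnitMultiples⊆z·u+T 1∉I H⊆T {u} x (σ , h , σ-unit , h∈H , x≈σ[u+h])
        with proj₁ reps σ
      ... | j , σ-zj∈I =
        j , j≢j₀ , λ k → resp (sym (eq k)) (+∈ (*∈ (u k) σ-zj∈I) (*∈ σ (H⊆T h∈H k)))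
        where
        j≢j₀ : ¬ j ≡ j₀
        j≢j₀ ≡.refl = unit∉ 1∉I σ-unit (x-y∈⇒y∈⇒x∈ σ-zj∈I zj₀∈I)
        eq : ∀ k → x k - z j * u k ≈ u k * (σ - z j) + σ * h k
        eq k = begin
          x k - z j * u k                  ≈⟨ +-congʳ (x≈σ[u+h] k) ⟩
          σ * (u k + h k) - z j * u k      ≈⟨ +-congʳ (distribˡ σ (u k) (h k)) ⟩
          σ * u k + σ * h k - z j * u k    ≈⟨ +-Comm.xy∙z≈xz∙y (σ * u k) (σ * h k) (- (z j * u k)) ⟩
          σ * u k - z j * u k + σ * h k    ≈⟨ +-congʳ (sym ([y-z]x≈yx-zx (u k) σ (z j))) ⟩
          (σ - z j) * u k + σ * h k        ≈⟨ +-congʳ (*-comm (σ - z j) (u k)) ⟩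
          u k * (σ - z j) + σ * h k        ∎

      z·u+T-disjoint : ∀ {m} {u : Tup m} → InV' u → ∀ {i j x} →
        InCoset I (z i ·ᵗ u) x → InCoset I (z j ·ᵗ u) x → i ≡ j
      z·u+T-disjoint {u = u} (k , uk-unit) {i} {j} x∈zi·u+T x∈zj·u+T = proj₂ reps i j
        (x*unit∈⇒x∈ uk-unit (resp (sym ([y-z]x≈yx-zx (u k) (z i) (z j)))
          (x-a∈⇒x-b∈⇒a-b∈ (x∈zi·u+T k) (x∈zj·u+T k))))

  record IsSquareZeroLocal (r : K) : Set (a ⊔ ℓ) where
    field
      1∉J     : ¬ ⟨ r ⟩ 1#
      ∉J⇒unit : ∀ {x} → ¬ ⟨ r ⟩ x → IsUnit x
      r*r≈0   : r * r ≈ 0#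
      J?      : ∀ x → Dec (⟨ r ⟩ x)

  module ThreeIdeals {r : K} (three : ExactlyThreeIdeals r) where
    private
      ⟨r⟩≉zero  = proj₁ three
      ⟨r⟩≉whole = proj₁ (proj₂ three)
      classify  = proj₂ (proj₂ three)
      module J  = IdealProperties (⟨⟩-isIdeal r)

    1∉J : ¬ ⟨ r ⟩ 1#
    1∉J 1∈J = ⟨r⟩≉whole (J.1∈⇒≐wholeRing 1∈J)

    ∉J⇒unit : ∀ {x} → ¬ ⟨ r ⟩ x → IsUnit x
    ∉J⇒unit {x} x∉J with classify ⟨ x ⟩ (⟨⟩-isIdeal x)
    ... | inj₁ ⟨x⟩≐0 = ⊥-elim (x∉J (J.resp (sym (lower (proj₁ (⟨x⟩≐0 x) (s∈⟨s⟩ x)))) J.zero∈))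
    ... | inj₂ (inj₁ ⟨x⟩≐⟨r⟩) = ⊥-elim (x∉J (proj₁ (⟨x⟩≐⟨r⟩ x) (s∈⟨s⟩ x)))
    ... | inj₂ (inj₂ ⟨x⟩≐K) with proj₂ (⟨x⟩≐K 1#) (lift tt)
    ...   | a , 1≈ax = a , trans (*-comm x a) (sym 1≈ax)

    r≈a[rr]⇒r≈0 : ∀ {a} → r ≈ a * (r * r) → r ≈ 0#
    r≈a[rr]⇒r≈0 {a} r≈a[rr] = x*unit≈0⇒x≈0 (J.1+∈⇒unit 1∉J ∉J⇒unit n∈J) (begin
      r * (1# + n)        ≈⟨ distribˡ r 1# n ⟩
      r * 1# + r * n      ≈⟨ +-cong (*-identityʳ r) (*-Comm.x∙yz≈y∙xz r (- a) r) ⟩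
      r + - a * (r * r)   ≈⟨ +-congˡ (sym (-‿distribˡ-* a (r * r))) ⟩
      r - a * (r * r)     ≈⟨ +-congˡ (-‿cong (sym r≈a[rr])) ⟩
      r - r               ≈⟨ -‿inverseʳ r ⟩
      0#                  ∎)
      where
      n = - a * r
      n∈J : ⟨ r ⟩ n
      n∈J = J.*∈ (- a) (s∈⟨s⟩ r)

    r≈0⇒⟨r⟩≐0 : r ≈ 0# → ⟨ r ⟩ ≐ zeroIdeal
    r≈0⇒⟨r⟩≐0 r≈0 x =
        (λ { (a , x≈ar) → lift (trans x≈ar (trans (*-congˡ r≈0) (zeroʳ a))) })
      , λ { (lift x≈0) → J.resp (sym x≈0) J.zero∈ }

    r*r≈0 : r * r ≈ 0#
    r*r≈0 with classify ⟨ r * r ⟩ (⟨⟩-isIdeal (r * r))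
    ... | inj₁ ⟨rr⟩≐0 = lower (proj₁ (⟨rr⟩≐0 (r * r)) (s∈⟨s⟩ (r * r)))
    ... | inj₂ (inj₁ ⟨rr⟩≐⟨r⟩) =
      ⊥-elim (⟨r⟩≉zero (r≈0⇒⟨r⟩≐0 (r≈a[rr]⇒r≈0 (proj₂ (proj₂ (⟨rr⟩≐⟨r⟩ r) (s∈⟨s⟩ r))))))
    ... | inj₂ (inj₂ ⟨rr⟩≐K) with proj₂ (⟨rr⟩≐K 1#) (lift tt)
    ...   | a , 1≈a[rr] = ⊥-elim (1∉J (J.resp (sym 1≈a[rr]) (J.*∈ a (J.*∈ r (s∈⟨s⟩ r)))))

    isSquareZeroLocal : (∀ x → Dec (⟨ r ⟩ x)) → IsSquareZeroLocal r
    isSquareZeroLocal J? = record { 1∉J = 1∉J ; ∉J⇒unit = ∉J⇒unit ; r*r≈0 = r*r≈0 ; J? = J? }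

  module SquareZeroLocal {r : K} (local : IsSquareZeroLocal r) where
    open IsSquareZeroLocal local
    private
      module J = IdealProperties (⟨⟩-isIdeal r)

    J*J≈0 : ∀ {x y} → ⟨ r ⟩ x → ⟨ r ⟩ y → x * y ≈ 0#
    J*J≈0 {x} {y} (a , x≈ar) (b , y≈br) = begin
      x * y              ≈⟨ *-cong x≈ar y≈br ⟩
      a * r * (b * r)    ≈⟨ *-Comm.interchange a r b r ⟩
      a * b * (r * r)    ≈⟨ *-congˡ r*r≈0 ⟩
      a * b * 0#         ≈⟨ zeroʳ (a * b) ⟩
      0#                 ∎

    Dependent : ∀ {n m} → (Fin n → Tup m) → Set (a ⊔ ℓ)
    Dependent vs = ∃[ cs ] ((∃[ i ] ¬ ⟨ r ⟩ (cs i)) × lincomb cs vs ≈ᵗ 0ᵗ)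

    ≈0-or-pivot : ∀ {m} (v : Tup m) → InT ⟨ r ⟩ v →
      v ≈ᵗ 0ᵗ ⊎ ∃[ k ] ∃[ a ] (IsUnit a × v k ≈ a * r)
    ≈0-or-pivot v v∈T with any? (λ k → ¬? (J? (proj₁ (v∈T k))))
    ... | yes (k , a∉J) = inj₂ (k , proj₁ (v∈T k) , ∉J⇒unit a∉J , proj₂ (v∈T k))
    ... | no no-pivot = inj₁ λ k → trans (proj₂ (v∈T k))
      (J*J≈0 (decidable-stable (J? _) (λ a∉J → no-pivot (k , a∉J))) (s∈⟨s⟩ r))

    head≈0⇒dependent : ∀ {n m} (vs : Fin (ℕ.suc n) → Tup m) → vs zero ≈ᵗ 0ᵗ → Dependent vs
    head≈0⇒dependent vs v₀≈0 = (1# ∷ λ _ → 0#) , (zero , 1∉J) , λ k →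
      trans (+-cong (trans (*-congˡ (v₀≈0 k)) (zeroʳ 1#)) (Σᴷ-zero λ i → zeroˡ (vs (suc i) k)))
            (+-identityʳ 0#)

    module Elimination {n m} (vs : Fin (ℕ.suc n) → Tup (ℕ.suc m)) (vs∈T : ∀ i → InT ⟨ r ⟩ (vs i))
                       {k a τ} (aτ≈1 : a * τ ≈ 1#) (v₀k≈ar : vs zero k ≈ a * r) where
      ms : Fin n → K
      ms i = proj₁ (vs∈T (suc i) k) * τ

      ws : Fin n → Tup (ℕ.suc m)
      ws i = vs (suc i) -ᵗ (ms i ·ᵗ vs zero)

      ws∈T : ∀ i → InT ⟨ r ⟩ (ws i ∘ punchIn k)
      ws∈T i l = J.-∈ (vs∈T (suc i) (punchIn k l)) (J.*∈ (ms i) (vs∈T zero (punchIn k l)))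

      ws-pivot≈0 : ∀ i → ws i k ≈ 0#
      ws-pivot≈0 i = begin
        vs (suc i) k - A * τ * vs zero k   ≈⟨ +-cong vᵢk≈Ar (-‿cong (*-congˡ v₀k≈ar)) ⟩
        A * r - A * τ * (a * r)            ≈⟨ +-congˡ (-‿cong (begin
            A * τ * (a * r)                    ≈⟨ *-congˡ (*-comm a r) ⟩
            A * τ * (r * a)                    ≈⟨ *-Comm.interchange A τ r a ⟩
            A * r * (τ * a)                    ≈⟨ *-congˡ (trans (*-comm τ a) aτ≈1) ⟩
            A * r * 1#                         ≈⟨ *-identityʳ (A * r) ⟩
            A * r                              ∎)) ⟩
        A * r - A * r                      ≈⟨ -‿inverseʳ (A * r) ⟩
        0#                                 ∎
        where
        A = proj₁ (vs∈T (suc i) k)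
        vᵢk≈Ar = proj₂ (vs∈T (suc i) k)

      lift-dependence : Dependent (λ i → ws i ∘ punchIn k) → Dependent vs
      lift-dependence (cs , (i , csᵢ∉J) , reduced≈0) =
        (Σᴷ (λ i → - (cs i * ms i)) ∷ cs) , (suc i , csᵢ∉J) , λ l →
          trans (Σᴷ-eliminate cs ms (λ i → vs (suc i) l) (vs zero l))
                (lincomb≈0-punchIn k ws-pivot≈0 reduced≈0 l)

    m<n⇒dependent : ∀ {m n} → m < n → (vs : Fin n → Tup m) → (∀ i → InT ⟨ r ⟩ (vs i)) →
      Dependent vs
    m<n⇒dependent {ℕ.zero} {ℕ.suc n} _ _ _ = (λ _ → 1#) , (zero , 1∉J) , λ ()
    m<n⇒dependent {ℕ.suc m} {ℕ.suc n} (s≤s m<n) vs vs∈T with ≈0-or-pivot (vs zero) (vs∈T zero)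
    ... | inj₁ v₀≈0 = head≈0⇒dependent vs v₀≈0
    ... | inj₂ (k , a , (τ , aτ≈1) , v₀k≈ar) =
      lift-dependence (m<n⇒dependent m<n (λ i → ws i ∘ punchIn k) ws∈T)
      where open Elimination vs vs∈T aτ≈1 v₀k≈ar

    module Hyperplane {m} {H : TSubset m} (hyperplane : IsHyperplane ⟨ r ⟩ H)
                      {u : Tup m} (ru∉H : ¬ H (r ·ᵗ u)) where
      private
        module S = IsSubspaceOfT (proj₁ hyperplane)
        b = proj₁ (proj₂ hyperplane)
        module B = IsBasis (proj₂ (proj₂ hyperplane))

      ru∈T : InT ⟨ r ⟩ (r ·ᵗ u)
      ru∈T k = u k , *-comm r (u k)

      K·ru+H : TSubset m
      K·ru+H t = ∃[ a ] ∃[ h ] (H h × t ≈ᵗ ((a ·ᵗ (r ·ᵗ u)) +ᵗ h))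

      T⊆K·ru+H : ∀ {t} → InT ⟨ r ⟩ t → K·ru+H t
      T⊆K·ru+H {t} t∈T = from-dependence (m<n⇒dependent (s≤s (m≤n+m∸n m 1)) vs vs∈T)
        where
        vs : Fin (ℕ.suc (ℕ.suc (m ∸ 1))) → Tup m
        vs = t ∷ (r ·ᵗ u) ∷ b

        vs∈T : ∀ i → InT ⟨ r ⟩ (vs i)
        vs∈T zero = t∈T
        vs∈T (suc zero) = ru∈T
        vs∈T (suc (suc i)) = S.⊆T (B.∈H i)

        from-dependence : Dependent vs → K·ru+H t
        from-dependence (cs , (i , csᵢ∉J) , d·t+c·ru+L≈0) = by-cases (J? d) (J? c)
          where
          d = cs zero
          c = cs (suc zero)
          L = lincomb (cs ∘ suc ∘ suc) b
          L∈H = lincomb∈ (proj₁ hyperplane) (cs ∘ suc ∘ suc) B.∈H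

          c·ru+L≈0 : ⟨ r ⟩ d → ∀ k → c * (r * u k) + L k ≈ 0#
          c·ru+L≈0 d∈J k = x≈0⇒x+y≈0⇒y≈0 (J*J≈0 d∈J (t∈T k)) (d·t+c·ru+L≈0 k)

          by-cases : Dec (⟨ r ⟩ d) → Dec (⟨ r ⟩ c) → K·ru+H t
          by-cases (no d∉J) _ with ∉J⇒unit d∉J
          ... | τ , dτ≈1 = - τ * c , (- τ) ·ᵗ L , S.·∈ (- τ) L∈H , λ k → begin
            t k                               ≈⟨ dx+y≈0⇒x≈-τy dτ≈1 (d·t+c·ru+L≈0 k) ⟩
            - τ * (c * (r * u k) + L k)       ≈⟨ distribˡ (- τ) _ (L k) ⟩
            - τ * (c * (r * u k)) + - τ * L k ≈⟨ +-congʳ (sym (*-assoc (- τ) c _)) ⟩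
            - τ * c * (r * u k) + - τ * L k   ∎
          by-cases (yes d∈J) (no c∉J) with ∉J⇒unit c∉J
          ... | τ , cτ≈1 = ⊥-elim (ru∉H (S.resp
            (λ k → sym (dx+y≈0⇒x≈-τy cτ≈1 (c·ru+L≈0 d∈J k))) (S.·∈ (- τ) L∈H)))
          by-cases (yes d∈J) (yes c∈J) = ⊥-elim (all∈J i csᵢ∉J)
            where
            L≈0 : L ≈ᵗ 0ᵗ
            L≈0 k = x≈0⇒x+y≈0⇒y≈0 (J*J≈0 c∈J (ru∈T k)) (c·ru+L≈0 d∈J k)
            all∈J : ∀ i → ¬ ¬ ⟨ r ⟩ (cs i)
            all∈J zero = λ d∉J → d∉J d∈J
            all∈J (suc zero) = λ c∉J → c∉J c∈J
            all∈J (suc (suc i)) = λ cᵢ∉J → cᵢ∉J (B.indep (cs ∘ suc ∘ suc) L≈0 i)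

      u+T⊆UnitMultiples : ∀ x → InCoset ⟨ r ⟩ u x → UnitMultiples H u x
      u+T⊆UnitMultiples x x-u∈T with T⊆K·ru+H x-u∈T
      ... | a , h , h∈H , x-u≈a·ru+h =
        1# + a * r , h , J.1+∈⇒unit 1∉J ∉J⇒unit ar∈J , h∈H , λ k → begin
          x k                                   ≈⟨ sym (//-rightDividesˡ (u k) (x k)) ⟩
          x k - u k + u k                       ≈⟨ +-congʳ (x-u≈a·ru+h k) ⟩
          a * (r * u k) + h k + u k             ≈⟨ +-Comm.xy∙z≈zy∙x _ (h k) (u k) ⟩
          u k + h k + a * (r * u k)             ≈⟨ +-congˡ (sym (*-assoc a r (u k))) ⟩
          u k + h k + a * r * u k               ≈⟨ +-congˡ (sym (+-identityʳ _)) ⟩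
          u k + h k + (a * r * u k + 0#)        ≈⟨ +-congˡ (+-congˡ (sym (J*J≈0 ar∈J (S.⊆T h∈H k)))) ⟩
          u k + h k + (a * r * u k + a * r * h k) ≈⟨ +-congˡ (sym (distribˡ (a * r) (u k) (h k))) ⟩
          u k + h k + a * r * (u k + h k)       ≈⟨ +-congʳ (sym (*-identityˡ _)) ⟩
          1# * (u k + h k) + a * r * (u k + h k) ≈⟨ sym (distribʳ _ 1# (a * r)) ⟩
          (1# + a * r) * (u k + h k)            ∎
        where
        ar∈J = J.*∈ a (s∈⟨s⟩ r)

      unit·u+T⊆UnitMultiples : ∀ {ρ} → IsUnit ρ →
        ∀ x → InCoset ⟨ r ⟩ (ρ ·ᵗ u) x → UnitMultiples H u x
      unit·u+T⊆UnitMultiples {ρ} ρ-unit@(τ , ρτ≈1) x x-ρu∈T =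
        rescale (u+T⊆UnitMultiples (τ ·ᵗ x) λ k → J.resp (τ[x-ρu]≈τx-u k) (J.*∈ τ (x-ρu∈T k)))
        where
        τ[x-ρu]≈τx-u : ∀ k → τ * (x k - ρ * u k) ≈ τ * x k - u k
        τ[x-ρu]≈τx-u k = begin
          τ * (x k - ρ * u k)       ≈⟨ x[y-z]≈xy-xz τ (x k) (ρ * u k) ⟩
          τ * x k - τ * (ρ * u k)   ≈⟨ +-congˡ (-‿cong (sym (*-assoc τ ρ (u k)))) ⟩
          τ * x k - τ * ρ * u k     ≈⟨ +-congˡ (-‿cong (*-congʳ (trans (*-comm τ ρ) ρτ≈1))) ⟩
          τ * x k - 1# * u k        ≈⟨ +-congˡ (-‿cong (*-identityˡ (u k))) ⟩
          τ * x k - u k             ∎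

        rescale : UnitMultiples H u (τ ·ᵗ x) → UnitMultiples H u x
        rescale (σ , h , σ-unit , h∈H , τx≈σ[u+h]) =
          ρ * σ , h , unit*unit ρ-unit σ-unit , h∈H , λ k → begin
            x k                        ≈⟨ sym (*-identityˡ (x k)) ⟩
            1# * x k                   ≈⟨ *-congʳ (sym ρτ≈1) ⟩
            ρ * τ * x k                ≈⟨ *-assoc ρ τ (x k) ⟩
            ρ * (τ * x k)              ≈⟨ *-congˡ (τx≈σ[u+h] k) ⟩
            ρ * (σ * (u k + h k))      ≈⟨ sym (*-assoc ρ σ (u k + h k)) ⟩
            ρ * σ * (u k + h k)        ∎

open import Data.Nat using (_*_)

lemma3p10 : ∀ {c ℓ} (R : CommutativeRing c ℓ) → let open RingDefs R in
    (e : ℕ) → 2 ≤ e →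
    IsFinite →
    (r : K) → ExactlyThreeIdeals r →
    (q : ℕ) → IsPrimePower q →
    (z : Fin q → K) → IsCosetReps ⟨ r ⟩ q z →
    (j₁ : Fin q) → IsZero (z j₁) →
    (H : TSubset (2 * e)) → IsHyperplane ⟨ r ⟩ H →
    (u : Tup (2 * e)) → InV' u → ¬ H (r ·ᵗ u) →
    ((∀ x → InCoset ⟨ r ⟩ u x → UnitMultiples H u x)
    × (∀ x → UnitMultiples H u x → ∃[ j ] (¬ j ≡ j₁ × InCoset ⟨ r ⟩ (z j ·ᵗ u) x))
    × (∀ j → ¬ j ≡ j₁ → ∀ x → InCoset ⟨ r ⟩ (z j ·ᵗ u) x → UnitMultiples H u x)
    × (∀ i j → ¬ i ≡ j₁ → ¬ j ≡ j₁ → ∀ x → InCoset ⟨ r ⟩ (z i ·ᵗ u) x → InCoset ⟨ r ⟩ (z j ·ᵗ u) x → i ≡ j))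
lemma3p10 R _ _ _ r three _ _ z reps j₁ zj₁≈0 H hyperplane u u∈V′ ru∉H =
    u+T⊆UnitMultiples
  , UnitMultiples⊆z·u+T 1∉J (IsSubspaceOfT.⊆T (proj₁ hyperplane))
  , (λ j j≢j₁ → unit·u+T⊆UnitMultiples (∉J⇒unit (j≢j₁ ∘ rep∈⇒≡)))
  , (λ _ _ _ _ _ → z·u+T-disjoint u∈V′)
  where
  open RingDefs R
  open ThreeIdeals R three
  module J = IdealProperties R (⟨⟩-isIdeal R r)
  open J.CosetRepresentatives reps (J.resp (CommutativeRing.sym R zj₁≈0) J.zero∈)
  open SquareZeroLocal R (isSquareZeroLocal ∈?)
  open Hyperplane hyperplane ru∉H
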